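{- Let $w$ be a word over $\{a,b\}$. Then $m(\mathrm{Lift}(w))\le m(w)$, and equality holds only if $\mathrm{Lift}(w)=w$.
   Context: Let $A=\begin{pmatrix}1&1\\1&2\end{pmatrix}$, $B=\begin{pmatrix}2&1\\1&1\end{pmatrix}$, and for $w=x_1\cdots x_k\in\{a,b\}^\star$ let $M^w=M^{x_1}\cdots M^{x_k}$ with $M^a=A$, $M^b=B$ ($M^w=I$ for the empty word); $m(w)=\begin{pmatrix}1&0\end{pmatrix}M^w\begin{pmatrix}0\\1\end{pmatrix}$. A word is identified with the lattice path from $(0,0)$ with $a$ = step $(1,0)$, $b$ = step $(0,1)$. Write $[d]=\{0,1,\dots,d\}$. For a word $w$ with $d$ letters $a$ and $n$ letters $b$, let $\mathrm{Bel}(w)=\{(u,v)\in[d]\times\mathbb{N} : \exists\, p\ge v \text{ such that the path } w \text{ passes through } (u,p)\}$. A finite set $S\subseteq\mathbb{N}^2$ is packed if for some $d$ it is contained in $[d]\times\mathbb{N}$, contains $(0,0)$, is closed under $(u,v)\mapsto(u+1,v)$ for $u\le d-1$, and under $(u,v)\mapsto(u,v-1)$ for $v\ge1$. The map $w\mapsto\mathrm{Bel}(w)$ is a bijection from words onto packed sets, with inverse $\mathrm{Hull}(S)$, the path through the points $\{(x,y)\in S:(x-1,y+1)\notin S\}$. Define $\delta_w:[d]\times\mathbb{N}\to\mathbb{R}$ by $\delta_w(x,y)=(dy-nx)/d$ if $d\ge1$, and $\delta_w(0,y)=y$ if $d=0$. The lifting of $w$ is $\mathrm{Lift}(w)=\mathrm{Hull}\big(\mathrm{Bel}(w)\cup\delta_w^{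 -1}(]-\infty,0[)\big)$, i.e. the word whose below-set is $\mathrm{Bel}(w)$ together with all points of $[d]\times\mathbb{N}$ lying strictly below the line through $(0,0)$ and $(d,n)$. -}

module Defs where

open import Data.Nat using (ℕ; zero; suc; _+_; _*_; _≤_; _<_)
open import Data.List using (List; []; _∷_)
open import Data.List.Membership.Propositional using (_∈_)
open import Data.Product using (_×_; _,_; ∃-syntax)
open import Data.Sum using (_⊎_)

data Letter : Set where
  a b : Letter

Word : Set
Word = List Letter

record Mat : Set where
  constructor mat
  field
    e11 e12 e21 e22 : ℕ
open Mat public

_⊗_ : Mat → Mat → Mat
mat p q r s ⊗ mat p' q' r' s' =
  mat (p * p' + q * r') (p * q' + q * s') (r * p' + s * r') (r * q' + s * s')

I₂ A B : Mat
I₂ = mat 1 0 0 1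
A = mat 1 1 1 2
B = mat 2 1 1 1

M : Letter → Mat
M a = A
M b = B

Mw : Word → Mat
Mw [] = I₂
Mw (x ∷ w) = M x ⊗ Mw w

-- m(w) = (1 0) M^w (0 1)ᵀ, i.e. the (1,2) entry
m : Word → ℕ
m w = e12 (Mw w)

#a #b : Word → ℕ
#a [] = 0
#a (a ∷ w) = suc (#a w)
#a (b ∷ w) = #a w
#b [] = 0
#b (a ∷ w) = #b w
#b (b ∷ w) = suc (#b w)

pathFrom : ℕ × ℕ → Word → List (ℕ × ℕ)
pathFrom (x , y) [] = (x , y) ∷ []
pathFrom (x , y) (a ∷ w) = (x , y) ∷ pathFrom (suc x , y) w
pathFrom (x , y) (b ∷ w) = (x , y) ∷ pathFrom (x , suc y) w

PassesThrough : Word → ℕ → ℕ → Set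
PassesThrough w u p = (u , p) ∈ pathFrom (0 , 0) w

Bel : Word → ℕ → ℕ → Set
Bel w u v = u ≤ #a w × ∃[ p ] (v ≤ p × PassesThrough w u p)

-- δ_w^{-1}(]-∞,0[) as a subset of [d] × ℕ.
-- For d ≥ 1: (d y - n x)/d < 0  ⟺  d * y < n * x.
-- For d = 0: δ_w(0,y) = y < 0 never holds; likewise d * y < n * x reads 0 < n * 0,
-- which is false, so the single formula covers both cases.
NegRegion : Word → ℕ → ℕ → Set
NegRegion w x y = x ≤ #a w × #a w * y < #b w * x

-- v is Lift(w) = Hull(Bel(w) ∪ δ_w^{-1}(]-∞,0[)), i.e. (since Bel is a bijection
-- from words onto packed sets with inverse Hull) v is the word whose below-set is
-- Bel(w) ∪ δ_w^{-1}(]-∞,0[).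
IsLift : Word → Word → Set
IsLift w v = ∀ x y → (Bel v x y → Bel w x y ⊎ NegRegion w x y)
                   × (Bel w x y ⊎ NegRegion w x y → Bel v x y)

-- Let d and n count the letters a and b of w, and let P = (e, t + 1) be the lowest lattice point
-- above the path in a column e where δ_w(P) is minimal, the leftmost such column. If δ_w(P) ≥ 0 the
-- lift adds nothing and Lift(w) = w. Otherwise the path turns a-then-b at column e, w = x a b y, and
-- flipping this corner to b a adds exactly P to Bel(w) without changing Lift(w); by induction on m it
-- remains to show m(x b a y) < m(x a b y).
-- With (p, q) the first row of M^x and (q′, s′) the second column of M^y this difference is
-- 2(q q′ − p s′), and since A and B are symmetric of determinant 1 it is unchanged when x and y are
-- extended outward by the same letter. So compare x read backwards with y read forwards: if the first
-- disagreement has a on the side of x and b on the side of y, the difference is positive. Any other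
-- outcome (b against a, or one side running out) yields two points R₁, R₂ with R₁ + R₂ = 2P, each
-- above the path or on the line through (0, 0) and (d, n), such that the choice of P gives
-- δ_w(R₁) ≥ δ_w(P) and δ_w(R₂) > δ_w(P), which is impossible as δ_w is affine.

module Submission where

open import Defs
open import Data.Nat using (_≤_)
open import Data.Product using (_×_)
open import Relation.Binary.PropositionalEquality using (_≡_)

open import Data.Nat
open import Data.Nat.Properties
open import Data.Nat.Induction using (<-wellFounded)
open import Data.Nat.Tactic.RingSolver
open import Data.Integer as ℤ using (ℤ; +_; 0ℤ)
import Data.Integer.Properties as ℤₚ
open import Data.Integer.Tactic.RingSolver using () renaming (solve-∀ to ℤ-solve-∀)
open import Data.List using ([]; _∷_; _++_; _∷ʳ_)
open import Data.List.Properties using (++-assoc; ++-identityʳ; ∷ʳ-++)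
open import Data.List.Reverse using (Reverse; reverseView; []; _∶_∶ʳ_)
open import Data.List.Relation.Unary.Any using (here; there)
open import Data.List.Membership.Propositional using (_∈_)
open import Data.Product using (_,_; proj₁; proj₂; ∃-syntax)
open import Data.Sum using (_⊎_; inj₁; inj₂)
open import Data.Empty using (⊥; ⊥-elim)
open import Function using (_∘_; _⇔_; mk⇔; Equivalence)
open import Induction.WellFounded using (Acc; acc)
open import Relation.Nullary using (yes; no; contradiction)
open import Relation.Binary.PropositionalEquality

mat-cong : ∀ {p q r s p′ q′ r′ s′} → p ≡ p′ → q ≡ q′ → r ≡ r′ → s ≡ s′ →
           mat p q r s ≡ mat p′ q′ r′ s′
mat-cong refl refl refl refl = refl

⊗-assoc : ∀ X Y Z → (X ⊗ Y) ⊗ Z ≡ X ⊗ (Y ⊗ Z)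
⊗-assoc (mat p q r s) (mat p′ q′ r′ s′) (mat p″ q″ r″ s″) =
  mat-cong (entry p q p′ q′ r′ s′ p″ r″) (entry p q p′ q′ r′ s′ q″ s″)
           (entry r s p′ q′ r′ s′ p″ r″) (entry r s p′ q′ r′ s′ q″ s″)
  where
  entry : ∀ α β p′ q′ r′ s′ γ δ → (α * p′ + β * r′) * γ + (α * q′ + β * s′) * δ
                                 ≡ α * (p′ * γ + q′ * δ) + β * (r′ * γ + s′ * δ)
  entry = solve-∀

⊗-identityˡ : ∀ X → I₂ ⊗ X ≡ X
⊗-identityˡ (mat p q r s) = mat-cong (entry p r) (entry q s) (entry′ p r) (entry′ q s)
  where
  entry : ∀ α β → 1 * α + 0 * β ≡ α
  entry = solve-∀
  entry′ : ∀ α β → 0 * α + 1 * β ≡ β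
  entry′ = solve-∀

Mw-++ : ∀ x y → Mw (x ++ y) ≡ Mw x ⊗ Mw y
Mw-++ []      y = sym (⊗-identityˡ (Mw y))
Mw-++ (l ∷ x) y = trans (cong (M l ⊗_) (Mw-++ x y)) (sym (⊗-assoc (M l) (Mw x) (Mw y)))

m-++ : ∀ x y → m (x ++ y) ≡ e11 (Mw x) * m y + e12 (Mw x) * e22 (Mw y)
m-++ x y rewrite Mw-++ x y with Mw x
... | mat _ _ _ _ = refl

SwapDecreases : Word → Word → Set
SwapDecreases x y = m (x ++ b ∷ a ∷ y) < m (x ++ a ∷ b ∷ y)

gap-transfer : ∀ {i j k l} → k + j ≡ l + i → i < j → k < l
gap-transfer {i} {j} {k} {l} eq i<j = +-cancelʳ-< i k l (subst (k + i <_) eq (+-monoʳ-< k i<j))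

swap-gap-invariant : ∀ l x y →
  m (x ++ l ∷ b ∷ a ∷ l ∷ y) + m (x ++ a ∷ b ∷ y)
    ≡ m (x ++ l ∷ a ∷ b ∷ l ∷ y) + m (x ++ b ∷ a ∷ y)
swap-gap-invariant l x y
  rewrite m-++ x (l ∷ b ∷ a ∷ l ∷ y) | m-++ x (a ∷ b ∷ y)
        | m-++ x (l ∷ a ∷ b ∷ l ∷ y) | m-++ x (b ∷ a ∷ y)
  with Mw x | Mw y | l
... | mat p q _ _ | mat _ q′ _ s′ | a = solve (p ∷ q ∷ q′ ∷ s′ ∷ [])
... | mat p q _ _ | mat _ q′ _ s′ | b = solve (p ∷ q ∷ q′ ∷ s′ ∷ [])

swap-decreases-wrap : ∀ l x y → SwapDecreases x y → SwapDecreases (x ∷ʳ l) (l ∷ y)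
swap-decreases-wrap l x y lt
  rewrite ∷ʳ-++ x l (b ∷ a ∷ l ∷ y) | ∷ʳ-++ x l (a ∷ b ∷ l ∷ y) =
  gap-transfer (swap-gap-invariant l x y) lt

swap-gap-a-b : ∀ x y → m (x ++ a ∷ b ∷ a ∷ b ∷ y) + 2 * m (x ++ y) ≤ m (x ++ a ∷ a ∷ b ∷ b ∷ y)
swap-gap-a-b x y
  rewrite m-++ x (a ∷ b ∷ a ∷ b ∷ y) | m-++ x y | m-++ x (a ∷ a ∷ b ∷ b ∷ y) with Mw x | Mw y
... | mat p q _ _ | mat _ q′ _ s′ =
  ≤-trans (m≤m+n _ (6 * (q * q′))) (≤-reflexive (solve (p ∷ q ∷ q′ ∷ s′ ∷ [])))

swap-decreases-a-b : ∀ x y → 0 < m (x ++ y) → SwapDecreases (x ∷ʳ a) (b ∷ y)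
swap-decreases-a-b x y pos
  rewrite ∷ʳ-++ x a (b ∷ a ∷ b ∷ y) | ∷ʳ-++ x a (a ∷ b ∷ b ∷ y) =
  <-≤-trans (m<m+n _ (≤-trans pos (m≤m+n _ _))) (swap-gap-a-b x y)

e22>0 : ∀ s → 0 < e22 (Mw s)
e22>0 []      = ≤-refl
e22>0 (a ∷ s) with Mw s | e22>0 s
... | mat _ q _ t | pos = ≤-trans pos (≤-trans (m≤n*m t 2) (m≤n+m (2 * t) (1 * q)))
e22>0 (b ∷ s) with Mw s | e22>0 s
... | mat _ q _ t | pos = ≤-trans pos (≤-trans (m≤n*m t 1) (m≤n+m (1 * t) (1 * q)))

m-∷>0 : ∀ l s → 0 < m (l ∷ s)
m-∷>0 a s with Mw s | e22>0 s
... | mat _ q _ t | pos = ≤-trans pos (≤-trans (m≤n*m t 1) (m≤n+m (1 * t) (1 * q)))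
m-∷>0 b s with Mw s | e22>0 s
... | mat _ q _ t | pos = ≤-trans pos (≤-trans (m≤n*m t 1) (m≤n+m (1 * t) (2 * q)))

m-nonempty>0 : ∀ x l y → 0 < m (x ++ l ∷ y)
m-nonempty>0 []      l y = m-∷>0 l y
m-nonempty>0 (k ∷ x) l y = m-∷>0 k (x ++ l ∷ y)

top : Word → ℕ → ℕ
top []      z       = 0
top (a ∷ w) zero    = 0
top (a ∷ w) (suc z) = top w z
top (b ∷ w) z       = suc (top w z)

#a-++ : ∀ s t → #a (s ++ t) ≡ #a s + #a t
#a-++ []      t = refl
#a-++ (a ∷ s) t = cong suc (#a-++ s t)
#a-++ (b ∷ s) t = #a-++ s t

#b-++ : ∀ s t → #b (s ++ t) ≡ #b s + #b t
#b-++ []      t = refl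
#b-++ (a ∷ s) t = #b-++ s t
#b-++ (b ∷ s) t = cong suc (#b-++ s t)

#a-prefix : ∀ s t → #a s ≤ #a (s ++ t)
#a-prefix s t = subst (#a s ≤_) (sym (#a-++ s t)) (m≤m+n _ _)

top-prefix : ∀ s t {z} → #a s ≡ suc z → top (s ++ t) z ≤ #b s
top-prefix (a ∷ s) t {zero}  eq = z≤n
top-prefix (a ∷ s) t {suc z} eq = top-prefix s t (suc-injective eq)
top-prefix (b ∷ s) t         eq = s≤s (top-prefix s t eq)

top-before-a : ∀ s t → top (s ++ a ∷ t) (#a s) ≡ #b s
top-before-a []      t = refl
top-before-a (a ∷ s) t = top-before-a s t
top-before-a (b ∷ s) t = cong suc (top-before-a s t)

top-last : ∀ w → top w (#a w) ≡ #b w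
top-last []      = refl
top-last (a ∷ w) = top-last w
top-last (b ∷ w) = cong suc (top-last w)

path-below-top : ∀ w x₀ y₀ {x y} → (x , y) ∈ pathFrom (x₀ , y₀) w →
                 ∃[ i ] x ≡ x₀ + i × y ≤ y₀ + top w i
path-below-top []      x₀ y₀ (here refl) = 0 , sym (+-identityʳ x₀) , ≤-reflexive (sym (+-identityʳ y₀))
path-below-top (a ∷ w) x₀ y₀ (here refl) = 0 , sym (+-identityʳ x₀) , ≤-reflexive (sym (+-identityʳ y₀))
path-below-top (b ∷ w) x₀ y₀ (here refl) = 0 , sym (+-identityʳ x₀) , m≤m+n y₀ _
path-below-top (a ∷ w) x₀ y₀ (there p) with path-below-top w (suc x₀) y₀ p
... | i , refl , y≤ = suc i , sym (+-suc x₀ i) , y≤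
path-below-top (b ∷ w) x₀ y₀ (there p) with path-below-top w x₀ (suc y₀) p
... | i , refl , y≤ = i , refl , ≤-trans y≤ (≤-reflexive (sym (+-suc y₀ (top w i))))

top-on-path : ∀ w x₀ y₀ i → i ≤ #a w → (x₀ + i , y₀ + top w i) ∈ pathFrom (x₀ , y₀) w
top-on-path []      x₀ y₀ zero    _ = here (cong₂ _,_ (+-identityʳ x₀) (+-identityʳ y₀))
top-on-path (a ∷ w) x₀ y₀ zero    _ = here (cong₂ _,_ (+-identityʳ x₀) (+-identityʳ y₀))
top-on-path (a ∷ w) x₀ y₀ (suc i) (s≤s i≤) =
  there (subst (λ x → (x , y₀ + top w i) ∈ pathFrom (suc x₀ , y₀) w) (sym (+-suc x₀ i))
               (top-on-path w (suc x₀) y₀ i i≤))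
top-on-path (b ∷ w) x₀ y₀ i       i≤ =
  there (subst (λ y → (x₀ + i , y) ∈ pathFrom (x₀ , suc y₀) w) (sym (+-suc y₀ (top w i)))
               (top-on-path w x₀ (suc y₀) i i≤))

Bel⇒≤top : ∀ w {x y} → Bel w x y → y ≤ top w x
Bel⇒≤top w (_ , p , y≤p , on) with path-below-top w 0 0 on
... | i , refl , p≤ = ≤-trans y≤p p≤

≤top⇒Bel : ∀ w {x y} → x ≤ #a w → y ≤ top w x → Bel w x y
≤top⇒Bel w {x} x≤ y≤ = x≤ , top w x , y≤ , top-on-path w 0 0 x x≤

top-injective : ∀ w v → #a v ≡ #a w → (∀ z → z ≤ #a w → top v z ≡ top w z) → v ≡ w
top-injective []      []      _  _    = refl
top-injective []      (a ∷ v) () _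
top-injective []      (b ∷ v) _  tops with () ← tops 0 z≤n
top-injective (a ∷ w) []      () _
top-injective (b ∷ w) []      _  tops with () ← tops 0 z≤n
top-injective (a ∷ w) (b ∷ v) _  tops with () ← tops 0 z≤n
top-injective (b ∷ w) (a ∷ v) _  tops with () ← tops 0 z≤n
top-injective (a ∷ w) (a ∷ v) eq tops =
  cong (a ∷_) (top-injective w v (suc-injective eq) (λ z z≤ → tops (suc z) (s≤s z≤)))
top-injective (b ∷ w) (b ∷ v) eq tops =
  cong (b ∷_) (top-injective w v eq (λ z z≤ → suc-injective (tops z z≤)))

corner : ∀ w e → e < #a w → top w e < top w (suc e) → ∃[ x ] ∃[ y ] w ≡ x ++ a ∷ b ∷ y × #a x ≡ e
corner (a ∷ b ∷ y) zero    _        _    = [] , y , refl , refl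
corner (a ∷ w)     (suc e) (s≤s e<) rise with corner w e e< rise
... | x , y , refl , refl = a ∷ x , y , refl , refl
corner (b ∷ w)     e       e<       rise with corner w e e< (≤-pred rise)
... | x , y , refl , refl = b ∷ x , y , refl , refl

#a-swap : ∀ x y → #a (x ++ b ∷ a ∷ y) ≡ #a (x ++ a ∷ b ∷ y)
#a-swap x y rewrite #a-++ x (b ∷ a ∷ y) | #a-++ x (a ∷ b ∷ y) = refl

#b-swap : ∀ x y → #b (x ++ b ∷ a ∷ y) ≡ #b (x ++ a ∷ b ∷ y)
#b-swap x y rewrite #b-++ x (b ∷ a ∷ y) | #b-++ x (a ∷ b ∷ y) = refl

top-swap-at : ∀ x y → top (x ++ b ∷ a ∷ y) (#a x) ≡ suc (top (x ++ a ∷ b ∷ y) (#a x))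
top-swap-at []      y = refl
top-swap-at (a ∷ x) y = top-swap-at x y
top-swap-at (b ∷ x) y = cong suc (top-swap-at x y)

top-swap-elsewhere : ∀ x y z → z ≢ #a x → top (x ++ b ∷ a ∷ y) z ≡ top (x ++ a ∷ b ∷ y) z
top-swap-elsewhere []      y zero    z≢ = ⊥-elim (z≢ refl)
top-swap-elsewhere []      y (suc z) z≢ = refl
top-swap-elsewhere (a ∷ x) y zero    z≢ = refl
top-swap-elsewhere (a ∷ x) y (suc z) z≢ = top-swap-elsewhere x y z (z≢ ∘ cong suc)
top-swap-elsewhere (b ∷ x) y z       z≢ = cong suc (top-swap-elsewhere x y z z≢)

leftmost-minimum : (f : ℕ → ℤ) (d : ℕ) →
  ∃[ e ] e ≤ d × (∀ z → z ≤ d → f e ℤ.≤ f z) × (∀ z → z < e → f e ℤ.< f z)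
leftmost-minimum f zero = 0 , z≤n , (λ { z z≤n → ℤₚ.≤-refl }) , (λ _ ())
leftmost-minimum f (suc d) with leftmost-minimum f d
... | e , e≤d , minimal , leftmost with f (suc d) ℤₚ.<? f e
...   | yes new<e = suc d , ≤-refl , minimal′ , leftmost′
  where
  minimal′ : ∀ z → z ≤ suc d → f (suc d) ℤ.≤ f z
  minimal′ z z≤ with m≤n⇒m<n∨m≡n z≤
  ... | inj₁ z<  = ℤₚ.≤-trans (ℤₚ.<⇒≤ new<e) (minimal z (≤-pred z<))
  ... | inj₂ refl = ℤₚ.≤-refl
  leftmost′ : ∀ z → z < suc d → f (suc d) ℤ.< f z
  leftmost′ z z< = ℤₚ.<-≤-trans new<e (minimal z (≤-pred z<))
...   | no  new≮e = e , m≤n⇒m≤1+n e≤d , minimal′ , leftmost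
  where
  minimal′ : ∀ z → z ≤ suc d → f e ℤ.≤ f z
  minimal′ z z≤ with m≤n⇒m<n∨m≡n z≤
  ... | inj₁ z<  = minimal z (≤-pred z<)
  ... | inj₂ refl = ℤₚ.≮⇒≥ new≮e

module Slope (w : Word) where

  D N : ℤ
  D = + #a w
  N = + #b w

  -- d · δ_w(x, y) in the notation of the paper, kept integral.
  δ : ℕ → ℕ → ℤ
  δ x y = D ℤ.* + y ℤ.- N ℤ.* + x

  Δ : Word → ℤ
  Δ s = δ (#a s) (#b s)

  -- δ at the lowest lattice point strictly above the path in column z, the first candidate for the lift.
  δ⁺ : ℕ → ℤ
  δ⁺ z = δ z (suc (top w z))

  δ-monoʳ-≤ : ∀ x {y y′} → y ≤ y′ → δ x y ℤ.≤ δ x y′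
  δ-monoʳ-≤ x y≤y′ = ℤₚ.+-monoˡ-≤ (ℤ.- (N ℤ.* + x)) (ℤₚ.*-monoˡ-≤-nonNeg D (ℤ.+≤+ y≤y′))

  δ-cancelʳ-< : ∀ x {y y′} → δ x y ℤ.< δ x y′ → y < y′
  δ-cancelʳ-< x {y} {y′} δ< with y <? y′
  ... | yes y<y′ = y<y′
  ... | no  y≮y′ = contradiction δ< (ℤₚ.≤⇒≯ (δ-monoʳ-≤ x (≮⇒≥ y≮y′)))

  δ-suc-y : ∀ x y → δ x (suc y) ≡ δ x y ℤ.+ D
  δ-suc-y x y rewrite ℤₚ.pos-+ 1 y = identity D N (+ x) (+ y)
    where
    identity : ∀ D N X Y → D ℤ.* (+ 1 ℤ.+ Y) ℤ.- N ℤ.* X ≡ D ℤ.* Y ℤ.- N ℤ.* X ℤ.+ D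
    identity = ℤ-solve-∀

  δ-diagonal : ∀ x y → δ x (suc y) ≡ δ (suc x) y ℤ.+ (D ℤ.+ N)
  δ-diagonal x y rewrite ℤₚ.pos-+ 1 y | ℤₚ.pos-+ 1 x = identity D N (+ x) (+ y)
    where
    identity : ∀ D N X Y → D ℤ.* (+ 1 ℤ.+ Y) ℤ.- N ℤ.* X
                         ≡ D ℤ.* Y ℤ.- N ℤ.* (+ 1 ℤ.+ X) ℤ.+ (D ℤ.+ N)
    identity = ℤ-solve-∀

  Δ-++ : ∀ s t → Δ (s ++ t) ≡ Δ s ℤ.+ Δ t
  Δ-++ s t rewrite #a-++ s t | #b-++ s t | ℤₚ.pos-+ (#a s) (#a t) | ℤₚ.pos-+ (#b s) (#b t) =
    identity D N (+ #a s) (+ #a t) (+ #b s) (+ #b t)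
    where
    identity : ∀ D N A A′ B B′ → D ℤ.* (B ℤ.+ B′) ℤ.- N ℤ.* (A ℤ.+ A′)
                               ≡ (D ℤ.* B ℤ.- N ℤ.* A) ℤ.+ (D ℤ.* B′ ℤ.- N ℤ.* A′)
    identity = ℤ-solve-∀

  Δ-whole : Δ w ≡ 0ℤ
  Δ-whole = identity D N
    where
    identity : ∀ D N → D ℤ.* N ℤ.- N ℤ.* D ≡ 0ℤ
    identity = ℤ-solve-∀

  Δ-[] : Δ [] ≡ 0ℤ
  Δ-[] = identity D N
    where
    identity : ∀ D N → D ℤ.* + 0 ℤ.- N ℤ.* + 0 ≡ 0ℤ
    identity = ℤ-solve-∀

  Δ-a : Δ (a ∷ []) ≡ ℤ.- N
  Δ-a = identity D N
    where
    identity : ∀ D N → D ℤ.* + 0 ℤ.- N ℤ.* + 1 ≡ ℤ.- N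
    identity = ℤ-solve-∀

  Δ-b : Δ (b ∷ []) ≡ D
  Δ-b = identity D N
    where
    identity : ∀ D N → D ℤ.* + 1 ℤ.- N ℤ.* + 0 ≡ D
    identity = ℤ-solve-∀

  δ≡difference : ∀ x y → δ x y ≡ + (#a w * y) ℤ.- + (#b w * x)
  δ≡difference x y rewrite ℤₚ.pos-* (#a w) y | ℤₚ.pos-* (#b w) x = refl

  below-line⇔ : ∀ x y → #a w * y < #b w * x ⇔ δ x y ℤ.< 0ℤ
  below-line⇔ x y = mk⇔ to from
    where
    to : #a w * y < #b w * x → δ x y ℤ.< 0ℤ
    to lt = ℤₚ.≰⇒> λ 0≤δ →
      <⇒≱ lt (ℤ.drop‿+≤+ (ℤₚ.0≤i-j⇒j≤i (subst (0ℤ ℤ.≤_) (δ≡difference x y) 0≤δ)))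
    from : δ x y ℤ.< 0ℤ → #a w * y < #b w * x
    from δ<0 = ≰⇒> λ le →
      ℤₚ.<⇒≱ δ<0 (subst (0ℤ ℤ.≤_) (sym (δ≡difference x y)) (ℤₚ.i≤j⇒0≤j-i (ℤ.+≤+ le)))

  δ⁺-last : δ⁺ (#a w) ≡ D
  δ⁺-last rewrite top-last w | ℤₚ.pos-+ 1 (#b w) = identity D N
    where
    identity : ∀ D N → D ℤ.* (+ 1 ℤ.+ N) ℤ.- N ℤ.* D ≡ D
    identity = ℤ-solve-∀

  δ-suc-x : ∀ x y → δ (suc x) y ℤ.+ N ≡ δ x y
  δ-suc-x x y rewrite ℤₚ.pos-+ 1 x = identity D N (+ x) (+ y)
    where
    identity : ∀ D N X Y → D ℤ.* Y ℤ.- N ℤ.* (+ 1 ℤ.+ X) ℤ.+ N ≡ D ℤ.* Y ℤ.- N ℤ.* X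
    identity = ℤ-solve-∀

  below⇒#b>0 : ∀ {x y} → δ x y ℤ.< 0ℤ → 0 < #b w
  below⇒#b>0 {x} {y} δ<0 with #b w | Equivalence.from (below-line⇔ x y) δ<0
  ... | suc _ | _ = s≤s z≤n

  corner-exists : ∀ e → e ≤ #a w → δ⁺ e ℤ.< 0ℤ → (∀ z → z ≤ #a w → δ⁺ e ℤ.≤ δ⁺ z) →
                  ∃[ x ] ∃[ y ] w ≡ x ++ a ∷ b ∷ y × #a x ≡ e
  corner-exists e e≤d below minimal = corner w e e<d rise
    where
    e<d : e < #a w
    e<d with m≤n⇒m<n∨m≡n e≤d
    ... | inj₁ e<  = e<
    ... | inj₂ refl = contradiction (subst (ℤ._< 0ℤ) δ⁺-last below) (ℤₚ.≤⇒≯ (ℤ.+≤+ z≤n))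
    rise : top w e < top w (suc e)
    rise = ≤-pred (δ-cancelʳ-< e (begin-strict
      δ⁺ e                       ≤⟨ minimal (suc e) e<d ⟩
      δ⁺ (suc e)                 ≡⟨ sym (ℤₚ.+-identityʳ _) ⟩
      δ⁺ (suc e) ℤ.+ 0ℤ          <⟨ ℤₚ.+-monoʳ-< (δ⁺ (suc e)) (ℤ.+<+ (below⇒#b>0 below)) ⟩
      δ⁺ (suc e) ℤ.+ N           ≡⟨ δ-suc-x e _ ⟩
      δ e (suc (top w (suc e)))  ∎))
      where open ℤₚ.≤-Reasoning

module MirrorArgument (w x₀ y₀ : Word) (w≡ : w ≡ x₀ ++ a ∷ b ∷ y₀) where

  open Slope w

  e : ℕ
  e = #a x₀

  module _ (below    : δ⁺ e ℤ.< 0ℤ)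
           (minimal  : ∀ z → z ≤ #a w → δ⁺ e ℤ.≤ δ⁺ z)
           (leftmost : ∀ z → z < e → δ⁺ e ℤ.< δ⁺ z) where

    -- Δ s + (D + N) is δ at (#a s − 1, #b s + 1), a point above the path when s is a prefix of w.
    column-bound : ∀ s r {z} → w ≡ s ++ r → #a s ≡ suc z → δ⁺ z ℤ.≤ Δ s ℤ.+ (D ℤ.+ N)
    column-bound s r {z} split #a≡ = begin
      δ z (suc (top w z))           ≤⟨ δ-monoʳ-≤ z (s≤s top≤) ⟩
      δ z (suc (#b s))              ≡⟨ δ-diagonal z (#b s) ⟩
      δ (suc z) (#b s) ℤ.+ (D ℤ.+ N) ≡⟨ cong (λ x → δ x (#b s) ℤ.+ (D ℤ.+ N)) (sym #a≡) ⟩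
      Δ s ℤ.+ (D ℤ.+ N)             ∎
      where
      open ℤₚ.≤-Reasoning
      top≤ : top w z ≤ #b s
      top≤ = subst (λ v → top v z ≤ #b s) (sym split) (top-prefix s r #a≡)

    origin-bound : ∀ s → #a s ≡ 0 → 0ℤ ℤ.≤ Δ s ℤ.+ (D ℤ.+ N)
    origin-bound s #a≡ = begin
      0ℤ                  ≡⟨ sym Δ-[] ⟩
      δ 0 0               ≤⟨ δ-monoʳ-≤ 0 z≤n ⟩
      δ 0 (#b s)          ≡⟨ cong (λ x → δ x (#b s)) (sym #a≡) ⟩
      Δ s                 ≤⟨ ℤₚ.i≤i+j (Δ s) (D ℤ.+ N) ⟩
      Δ s ℤ.+ (D ℤ.+ N)   ∎
      where open ℤₚ.≤-Reasoning

    prefix-bound : ∀ s r → w ≡ s ++ r → δ⁺ e ℤ.≤ Δ s ℤ.+ (D ℤ.+ N)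
    prefix-bound s r split = by-count (#a s) refl
      where
      by-count : ∀ k → #a s ≡ k → δ⁺ e ℤ.≤ Δ s ℤ.+ (D ℤ.+ N)
      by-count zero    #a≡ = ℤₚ.<⇒≤ (ℤₚ.<-≤-trans below (origin-bound s #a≡))
      by-count (suc z) #a≡ = ℤₚ.≤-trans (minimal z z≤d) (column-bound s r split #a≡)
        where
        z≤d : z ≤ #a w
        z≤d = ≤-trans (n≤1+n z)
                (subst (_≤ #a w) #a≡ (subst (λ v → #a s ≤ #a v) (sym split) (#a-prefix s r)))

    prefix-bound-strict : ∀ s r → w ≡ s ++ r → #a s ≤ e → δ⁺ e ℤ.< Δ s ℤ.+ (D ℤ.+ N)
    prefix-bound-strict s r split s≤e = by-count (#a s) refl
      where
      by-count : ∀ k → #a s ≡ k → δ⁺ e ℤ.< Δ s ℤ.+ (D ℤ.+ N)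
      by-count zero    #a≡ = ℤₚ.<-≤-trans below (origin-bound s #a≡)
      by-count (suc z) #a≡ =
        ℤₚ.<-≤-trans (leftmost z (subst (_≤ e) #a≡ s≤e)) (column-bound s r split #a≡)

    no-balanced-pair : ∀ {r₁ r₂} → δ⁺ e ℤ.≤ r₁ → δ⁺ e ℤ.< r₂ → r₁ ℤ.+ r₂ ≡ δ⁺ e ℤ.+ δ⁺ e → ⊥
    no-balanced-pair h₁ h₂ eq = ℤₚ.<-irrefl (sym eq) (ℤₚ.+-mono-≤-< h₁ h₂)

    below-whole : δ⁺ e ℤ.< Δ w
    below-whole = subst (δ⁺ e ℤ.<_) (sym Δ-whole) below

    -- Through δ: the endpoints of x and of x ++ mid are symmetric about the centre of the corner square.
    Balanced : Word → Word → Set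
    Balanced x mid = Δ x ℤ.+ Δ x ℤ.+ Δ mid ℤ.+ (D ℤ.+ N) ≡ δ⁺ e ℤ.+ δ⁺ e

    balanced-wrap : ∀ x l mid → Balanced (x ∷ʳ l) mid → Balanced x (l ∷ mid ∷ʳ l)
    balanced-wrap x l mid balanced = begin
      Δ x ℤ.+ Δ x ℤ.+ Δ (l ∷ mid ∷ʳ l) ℤ.+ (D ℤ.+ N)
        ≡⟨ cong (λ v → Δ x ℤ.+ Δ x ℤ.+ v ℤ.+ (D ℤ.+ N)) Δ-wrapped ⟩
      Δ x ℤ.+ Δ x ℤ.+ (L ℤ.+ (Δ mid ℤ.+ L)) ℤ.+ (D ℤ.+ N)
        ≡⟨ identity (Δ x) L (Δ mid) (D ℤ.+ N) ⟩
      (Δ x ℤ.+ L) ℤ.+ (Δ x ℤ.+ L) ℤ.+ Δ mid ℤ.+ (D ℤ.+ N)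
        ≡⟨ cong (λ v → v ℤ.+ v ℤ.+ Δ mid ℤ.+ (D ℤ.+ N)) (sym (Δ-++ x (l ∷ []))) ⟩
      Δ (x ∷ʳ l) ℤ.+ Δ (x ∷ʳ l) ℤ.+ Δ mid ℤ.+ (D ℤ.+ N)
        ≡⟨ balanced ⟩
      δ⁺ e ℤ.+ δ⁺ e ∎
      where
      open ≡-Reasoning
      L = Δ (l ∷ [])
      Δ-wrapped : Δ (l ∷ mid ∷ʳ l) ≡ L ℤ.+ (Δ mid ℤ.+ L)
      Δ-wrapped = trans (Δ-++ (l ∷ []) (mid ∷ʳ l)) (cong (ℤ._+_ L) (Δ-++ mid (l ∷ [])))
      identity : ∀ X L M C → X ℤ.+ X ℤ.+ (L ℤ.+ (M ℤ.+ L)) ℤ.+ C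
                           ≡ (X ℤ.+ L) ℤ.+ (X ℤ.+ L) ℤ.+ M ℤ.+ C
      identity = ℤ-solve-∀

    reaches-start-impossible : ∀ mid y → w ≡ mid ++ y → Balanced [] mid → ⊥
    reaches-start-impossible mid y split balanced =
      no-balanced-pair (prefix-bound mid y split) below (begin
        Δ mid ℤ.+ (D ℤ.+ N) ℤ.+ 0ℤ               ≡⟨ identity (Δ mid) (D ℤ.+ N) ⟩
        0ℤ ℤ.+ 0ℤ ℤ.+ Δ mid ℤ.+ (D ℤ.+ N)        ≡⟨ cong (λ z → z ℤ.+ z ℤ.+ Δ mid ℤ.+ (D ℤ.+ N)) (sym Δ-[]) ⟩
        Δ [] ℤ.+ Δ [] ℤ.+ Δ mid ℤ.+ (D ℤ.+ N)    ≡⟨ balanced ⟩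
        δ⁺ e ℤ.+ δ⁺ e                            ∎)
      where
      open ≡-Reasoning
      identity : ∀ M C → M ℤ.+ C ℤ.+ 0ℤ ≡ 0ℤ ℤ.+ 0ℤ ℤ.+ M ℤ.+ C
      identity = ℤ-solve-∀

    reaches-end-impossible : ∀ x mid → w ≡ x ++ mid → #a x ≤ e → Balanced x mid → ⊥
    reaches-end-impossible x mid split x≤e balanced =
      no-balanced-pair (ℤₚ.<⇒≤ below-whole) (prefix-bound-strict x mid split x≤e) (begin
        Δ w ℤ.+ (Δ x ℤ.+ (D ℤ.+ N))                  ≡⟨ cong (ℤ._+ _) (trans (cong Δ split) (Δ-++ x mid)) ⟩
        Δ x ℤ.+ Δ mid ℤ.+ (Δ x ℤ.+ (D ℤ.+ N))        ≡⟨ identity (Δ x) (Δ mid) (D ℤ.+ N) ⟩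
        Δ x ℤ.+ Δ x ℤ.+ Δ mid ℤ.+ (D ℤ.+ N)          ≡⟨ balanced ⟩
        δ⁺ e ℤ.+ δ⁺ e                                ∎)
      where
      open ≡-Reasoning
      identity : ∀ X M C → X ℤ.+ M ℤ.+ (X ℤ.+ C) ≡ X ℤ.+ X ℤ.+ M ℤ.+ C
      identity = ℤ-solve-∀

    divergence-b-a-impossible : ∀ x mid y → w ≡ (x ∷ʳ b) ++ mid ++ a ∷ y → #a x ≤ e →
                                Balanced (x ∷ʳ b) mid → ⊥
    divergence-b-a-impossible x mid y split x≤e balanced =
      no-balanced-pair (prefix-bound ((x ∷ʳ b) ++ mid ∷ʳ a) y split₁)
                       (prefix-bound-strict x (b ∷ mid ++ a ∷ y) split₂ x≤e) (begin
        Δ ((x ∷ʳ b) ++ mid ∷ʳ a) ℤ.+ (D ℤ.+ N) ℤ.+ (Δ x ℤ.+ (D ℤ.+ N))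
          ≡⟨ cong (λ v → v ℤ.+ (D ℤ.+ N) ℤ.+ (Δ x ℤ.+ (D ℤ.+ N))) Δ-prefix ⟩
        (Δ x ℤ.+ D) ℤ.+ (Δ mid ℤ.+ ℤ.- N) ℤ.+ (D ℤ.+ N) ℤ.+ (Δ x ℤ.+ (D ℤ.+ N))
          ≡⟨ identity (Δ x) (Δ mid) D N ⟩
        (Δ x ℤ.+ D) ℤ.+ (Δ x ℤ.+ D) ℤ.+ Δ mid ℤ.+ (D ℤ.+ N)
          ≡⟨ cong (λ v → v ℤ.+ v ℤ.+ Δ mid ℤ.+ (D ℤ.+ N)) (sym Δ-xb) ⟩
        Δ (x ∷ʳ b) ℤ.+ Δ (x ∷ʳ b) ℤ.+ Δ mid ℤ.+ (D ℤ.+ N)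
          ≡⟨ balanced ⟩
        δ⁺ e ℤ.+ δ⁺ e ∎)
      where
      open ≡-Reasoning
      split₁ : w ≡ ((x ∷ʳ b) ++ mid ∷ʳ a) ++ y
      split₁ = trans split (trans (cong ((x ∷ʳ b) ++_) (sym (∷ʳ-++ mid a y)))
                                  (sym (++-assoc (x ∷ʳ b) (mid ∷ʳ a) y)))
      split₂ : w ≡ x ++ b ∷ mid ++ a ∷ y
      split₂ = trans split (∷ʳ-++ x b (mid ++ a ∷ y))
      Δ-xb : Δ (x ∷ʳ b) ≡ Δ x ℤ.+ D
      Δ-xb = trans (Δ-++ x (b ∷ [])) (cong (ℤ._+_ (Δ x)) Δ-b)
      Δ-prefix : Δ ((x ∷ʳ b) ++ mid ∷ʳ a) ≡ (Δ x ℤ.+ D) ℤ.+ (Δ mid ℤ.+ ℤ.- N)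
      Δ-prefix = trans (Δ-++ (x ∷ʳ b) (mid ∷ʳ a))
                       (cong₂ ℤ._+_ Δ-xb (trans (Δ-++ mid (a ∷ [])) (cong (ℤ._+_ (Δ mid)) Δ-a)))
      identity : ∀ X M D N → (X ℤ.+ D) ℤ.+ (M ℤ.+ ℤ.- N) ℤ.+ (D ℤ.+ N) ℤ.+ (X ℤ.+ (D ℤ.+ N))
                           ≡ (X ℤ.+ D) ℤ.+ (X ℤ.+ D) ℤ.+ M ℤ.+ (D ℤ.+ N)
      identity = ℤ-solve-∀

    divergence-a-b-alone-impossible : ∀ mid → w ≡ a ∷ mid ++ b ∷ [] → Balanced (a ∷ []) mid → ⊥
    divergence-a-b-alone-impossible mid split balanced =
      no-balanced-pair (ℤₚ.<⇒≤ below) below-whole (begin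
        0ℤ ℤ.+ Δ w                                        ≡⟨ cong (ℤ._+_ 0ℤ) Δ-w ⟩
        0ℤ ℤ.+ (ℤ.- N ℤ.+ (Δ mid ℤ.+ D))                  ≡⟨ identity (Δ mid) D N ⟩
        ℤ.- N ℤ.+ ℤ.- N ℤ.+ Δ mid ℤ.+ (D ℤ.+ N)           ≡⟨ cong (λ v → v ℤ.+ v ℤ.+ Δ mid ℤ.+ (D ℤ.+ N)) (sym Δ-a) ⟩
        Δ (a ∷ []) ℤ.+ Δ (a ∷ []) ℤ.+ Δ mid ℤ.+ (D ℤ.+ N) ≡⟨ balanced ⟩
        δ⁺ e ℤ.+ δ⁺ e                                     ∎)
      where
      open ≡-Reasoning
      Δ-w : Δ w ≡ ℤ.- N ℤ.+ (Δ mid ℤ.+ D)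
      Δ-w = trans (cong Δ split)
                  (trans (Δ-++ (a ∷ []) (mid ++ b ∷ []))
                         (cong₂ ℤ._+_ Δ-a (trans (Δ-++ mid (b ∷ [])) (cong (ℤ._+_ (Δ mid)) Δ-b))))
      identity : ∀ M D N → 0ℤ ℤ.+ (ℤ.- N ℤ.+ (M ℤ.+ D))
                         ≡ ℤ.- N ℤ.+ ℤ.- N ℤ.+ M ℤ.+ (D ℤ.+ N)
      identity = ℤ-solve-∀

    divergence-a-b>0 : ∀ {x} → Reverse x → ∀ y {mid} → w ≡ (x ∷ʳ a) ++ mid ++ b ∷ y →
                       Balanced (x ∷ʳ a) mid → 0 < m (x ++ y)
    divergence-a-b>0 {x} _           (l ∷ y) _     _        = m-nonempty>0 x l y
    divergence-a-b>0 (x ∶ _ ∶ʳ l)  []      _     _        =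
      subst (λ v → 0 < m v) (sym (++-identityʳ (x ∷ʳ l))) (m-nonempty>0 x l [])
    divergence-a-b>0 []            []      split balanced =
      ⊥-elim (divergence-a-b-alone-impossible _ split balanced)

    swap-decreases-balanced : ∀ y x mid → w ≡ x ++ mid ++ y → #a x ≤ e → Balanced x mid →
                              SwapDecreases x y
    swap-decreases-balanced [] x mid split x≤e balanced =
      ⊥-elim (reaches-end-impossible x mid (trans split (cong (x ++_) (++-identityʳ mid))) x≤e balanced)
    swap-decreases-balanced (l′ ∷ y) x mid split x≤e balanced with reverseView x
    ... | []            = ⊥-elim (reaches-start-impossible mid (l′ ∷ y) split balanced)
    ... | x′ ∶ rest ∶ʳ l = by-letters l l′ split balanced
      where
      x′≤e : #a x′ ≤ e
      x′≤e = ≤-trans (#a-prefix x′ (l ∷ [])) x≤e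

      wrap : ∀ l → w ≡ (x′ ∷ʳ l) ++ mid ++ l ∷ y → Balanced (x′ ∷ʳ l) mid →
             SwapDecreases (x′ ∷ʳ l) (l ∷ y)
      wrap l split balanced = swap-decreases-wrap l x′ y
        (swap-decreases-balanced y x′ (l ∷ mid ∷ʳ l) split′ x′≤e (balanced-wrap x′ l mid balanced))
        where
        split′ : w ≡ x′ ++ (l ∷ mid ∷ʳ l) ++ y
        split′ = trans split (trans (∷ʳ-++ x′ l (mid ++ l ∷ y))
                                    (cong (λ t → x′ ++ l ∷ t) (sym (∷ʳ-++ mid l y))))

      by-letters : ∀ l l′ → w ≡ (x′ ∷ʳ l) ++ mid ++ l′ ∷ y → Balanced (x′ ∷ʳ l) mid →
                   SwapDecreases (x′ ∷ʳ l) (l′ ∷ y)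
      by-letters a a = wrap a
      by-letters b b = wrap b
      by-letters a b split balanced = swap-decreases-a-b x′ y (divergence-a-b>0 rest y split balanced)
      by-letters b a split balanced = ⊥-elim (divergence-b-a-impossible x′ mid y split x′≤e balanced)

    corner-value : δ⁺ e ≡ Δ x₀ ℤ.+ D
    corner-value = trans (cong (λ t → δ e (suc t)) top-e) (δ-suc-y e (#b x₀))
      where
      top-e : top w e ≡ #b x₀
      top-e = trans (cong (λ v → top v e) w≡) (top-before-a x₀ (b ∷ y₀))

    swap-decreases : SwapDecreases x₀ y₀
    swap-decreases = swap-decreases-balanced y₀ x₀ (a ∷ b ∷ []) w≡ ≤-refl
      (trans (identity (Δ x₀) D N) (sym (cong₂ ℤ._+_ corner-value corner-value)))
      where
      identity : ∀ X D N → X ℤ.+ X ℤ.+ (D ℤ.* + 1 ℤ.- N ℤ.* + 1) ℤ.+ (D ℤ.+ N)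
                         ≡ (X ℤ.+ D) ℤ.+ (X ℤ.+ D)
      identity = ℤ-solve-∀

IsLiftByColumns : Word → Word → Set
IsLiftByColumns w v = #a v ≡ #a w ×
  (∀ z h → z ≤ #a w → h ≤ top v z ⇔ (h ≤ top w z ⊎ #a w * h < #b w * z))

IsLift⇒IsLiftByColumns : ∀ w v → IsLift w v → IsLiftByColumns w v
IsLift⇒IsLiftByColumns w v lift = ≤-antisym #a-v≤ #a-w≤ , λ z h z≤ → mk⇔ (to z h z≤) (from z h z≤)
  where
  #a-v≤ : #a v ≤ #a w
  #a-v≤ with proj₁ (lift (#a v) 0) (≤top⇒Bel v ≤-refl z≤n)
  ... | inj₁ bel = proj₁ bel
  ... | inj₂ neg = proj₁ neg
  #a-w≤ : #a w ≤ #a v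
  #a-w≤ = proj₁ (proj₂ (lift (#a w) 0) (inj₁ (≤top⇒Bel w ≤-refl z≤n)))
  to : ∀ z h → z ≤ #a w → h ≤ top v z → h ≤ top w z ⊎ #a w * h < #b w * z
  to z h z≤ h≤ with proj₁ (lift z h) (≤top⇒Bel v (≤-trans z≤ #a-w≤) h≤)
  ... | inj₁ bel = inj₁ (Bel⇒≤top w bel)
  ... | inj₂ neg = inj₂ (proj₂ neg)
  from : ∀ z h → z ≤ #a w → h ≤ top w z ⊎ #a w * h < #b w * z → h ≤ top v z
  from z h z≤ (inj₁ h≤)  = Bel⇒≤top v (proj₂ (lift z h) (inj₁ (≤top⇒Bel w z≤ h≤)))
  from z h z≤ (inj₂ neg) = Bel⇒≤top v (proj₂ (lift z h) (inj₂ (z≤ , neg)))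

lift-after-swap : ∀ {w} x y v → w ≡ x ++ a ∷ b ∷ y → #a w * suc (top w (#a x)) < #b w * #a x →
                  IsLiftByColumns w v → IsLiftByColumns (x ++ b ∷ a ∷ y) v
lift-after-swap {w} x y v refl below (#a≡ , columns) = trans #a≡ (sym (#a-swap x y)) , columns′
  where
  w′ = x ++ b ∷ a ∷ y
  columns′ : ∀ z h → z ≤ #a w′ → h ≤ top v z ⇔ (h ≤ top w′ z ⊎ #a w′ * h < #b w′ * z)
  columns′ z h z≤ rewrite #a-swap x y | #b-swap x y with z ≟ #a x
  ... | no z≢ rewrite top-swap-elsewhere x y z z≢ = columns z h z≤
  ... | yes refl rewrite top-swap-at x y = mk⇔ to from
    where
    open Equivalence (columns (#a x) h z≤) renaming (to to to-w; from to from-w)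
    to : h ≤ top v (#a x) → h ≤ suc (top w (#a x)) ⊎ #a w * h < #b w * #a x
    to h≤ with to-w h≤
    ... | inj₁ h≤top = inj₁ (m≤n⇒m≤1+n h≤top)
    ... | inj₂ neg   = inj₂ neg
    from : h ≤ suc (top w (#a x)) ⊎ #a w * h < #b w * #a x → h ≤ top v (#a x)
    from (inj₂ neg) = from-w (inj₂ neg)
    from (inj₁ h≤) with m≤n⇒m<n∨m≡n h≤
    ... | inj₁ h<   = from-w (inj₁ (≤-pred h<))
    ... | inj₂ refl = from-w (inj₂ below)

module _ (w : Word) where
  open Slope w

  lift-trivial : ∀ v → (∀ z → z ≤ #a w → 0ℤ ℤ.≤ δ⁺ z) → IsLiftByColumns w v → v ≡ w
  lift-trivial v above (#a≡ , columns) = top-injective w v #a≡ same-top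
    where
    same-top : ∀ z → z ≤ #a w → top v z ≡ top w z
    same-top z z≤ = ≤-antisym top-v≤ (Equivalence.from (columns z (top w z) z≤) (inj₁ ≤-refl))
      where
      top-v≤ : top v z ≤ top w z
      top-v≤ with Equivalence.to (columns z (top v z) z≤) ≤-refl
      ... | inj₁ v≤w = v≤w
      ... | inj₂ neg = ≤-pred (δ-cancelʳ-< z
                         (ℤₚ.<-≤-trans (Equivalence.to (below-line⇔ z (top v z)) neg) (above z z≤)))

  lift-trivial-or-swap : ∀ v → IsLiftByColumns w v →
    v ≡ w ⊎ ∃[ x ] ∃[ y ] w ≡ x ++ a ∷ b ∷ y × SwapDecreases x y
                         × IsLiftByColumns (x ++ b ∷ a ∷ y) v
  lift-trivial-or-swap v lift with leftmost-minimum δ⁺ (#a w)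
  ... | e , e≤d , minimal , leftmost with δ⁺ e ℤₚ.<? 0ℤ
  ...   | no  above = inj₁ (lift-trivial v (λ z z≤ → ℤₚ.≤-trans (ℤₚ.≮⇒≥ above) (minimal z z≤)) lift)
  ...   | yes below with corner-exists e e≤d below minimal
  ...     | x , y , w≡ , refl = inj₂ (x , y , w≡ , decreases , lift-after-swap x y v w≡ P-below lift)
    where
    decreases : SwapDecreases x y
    decreases = MirrorArgument.swap-decreases w x y w≡ below minimal leftmost
    P-below : #a w * suc (top w (#a x)) < #b w * #a x
    P-below = Equivalence.from (below-line⇔ (#a x) _) below

lift-decreases : ∀ w → Acc _<_ (m w) → ∀ v → IsLiftByColumns w v → m v ≤ m w × (m v ≡ m w → v ≡ w)
lift-decreases w (acc smaller) v lift with lift-trivial-or-swap w v lift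
... | inj₁ refl = ≤-refl , λ _ → refl
... | inj₂ (x , y , refl , decreases , lift′) =
  ≤-trans v≤ (<⇒≤ decreases) , λ v≡ → ⊥-elim (<⇒≢ (≤-<-trans v≤ decreases) v≡)
  where
  v≤ : m v ≤ m (x ++ b ∷ a ∷ y)
  v≤ = proj₁ (lift-decreases (x ++ b ∷ a ∷ y) (smaller decreases) v lift′)

lemma3p4 : ∀ (w v : Word) → IsLift w v → m v ≤ m w × (m v ≡ m w → v ≡ w)
lemma3p4 w v lift = lift-decreases w (<-wellFounded (m w)) v (IsLift⇒IsLiftByColumns w v lift)
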